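{- Let $q$ be a prime power and $r,t\ge 2$ integers, and let $\alpha:\mathrm{PG}(r-1,q^t)\to \mathrm{PG}(r^t-1,q^t)$ be the map defined in the context. Let $\Pi_0,\Pi_1,\ldots,\Pi_{t-1}$ be (projective) subspaces of $\mathrm{PG}(r-1,q^t)$ and let $P\in\mathrm{PG}(r-1,q^t)$ be a point not contained in any of $\Pi_0,\ldots,\Pi_{t-1}$. Then $P^{\alpha}$ is not contained in the projective subspace $\langle \Pi_0^{\alpha},\Pi_1^{\alpha},\ldots,\Pi_{t-1}^{\alpha}\rangle$ of $\mathrm{PG}(r^t-1,q^t)$ spanned by $\Pi_0^{\alpha}\cup\cdots\cup\Pi_{t-1}^{\alpha}$.
   Context: $\mathrm{PG}(n-1,K)$ denotes the projective space of the vector space $K^n$. Let $\mathfrak F$ be the set of all functions $f:\{0,\ldots,t-1\}\to\{0,\ldots,r-1\}$ (so $|\mathfrak F|=r^t$), listed in a fixed order and used to index the coordinates of $\mathrm{PG}(r^t-1,q^t)$. For a point $P=\langle (x_0,\ldots,x_{r-1})\rangle$ of $\mathrm{PG}(r-1,q^t)$, $P^{\alpha}$ is the point of $\mathrm{PG}(r^t-1,q^t)$ whose coordinate indexed by $f\in\mathfrak F$ is $\prod_{i=0}^{t-1}x_{f(i)}^{q^i}$ (this is well defined on projective points and $\alpha$ is injective). For a subset $\Pi$ of $\mathrm{PG}(r-1,q^t)$, $\Pi^{\alpha}=\{Q^{\alpha}:Q\in\Pi\}$. The image of $\alpha$ is the variety $\mathcal V_{r,t}$. -}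

module Defs where

open import Level using (Level; _⊔_) renaming (suc to lsuc)
open import Algebra.Bundles using (CommutativeRing)
open import Data.Nat using (ℕ; zero; suc; _^_; _≥_)
open import Data.Nat.Primality using (Prime)
open import Data.Fin using (Fin; zero; suc; toℕ)
open import Data.List using (List; []; _∷_)
open import Data.List.Relation.Unary.All using (All)
open import Data.Product using (Σ; ∃; ∃-syntax; _×_; _,_; proj₁; proj₂)
open import Relation.Binary.PropositionalEquality using (_≡_)
open import Relation.Nullary using (¬_)

IsPrimePower : ℕ → Set
IsPrimePower q = Σ ℕ λ p → Σ ℕ λ e → Prime p × e ≥ 1 × q ≡ p ^ e

module FieldTheory {c ℓ : Level} (K : CommutativeRing c ℓ) where
  open CommutativeRing K using (Carrier; _≈_; _+_; _*_; 0#; 1#)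

  record IsField : Set (c ⊔ ℓ) where
    field
      0≉1     : ¬ (0# ≈ 1#)
      inverse : ∀ x → ¬ (x ≈ 0#) → Σ Carrier λ y → x * y ≈ 1#

  HasCardinality : ℕ → Set (c ⊔ ℓ)
  HasCardinality N = Σ (Fin N → Carrier) λ e →
    (∀ i j → e i ≈ e j → i ≡ j) × (∀ x → Σ (Fin N) λ i → e i ≈ x)

  pow : Carrier → ℕ → Carrier
  pow x zero    = 1#
  pow x (suc n) = x * pow x n

  prodFin : (n : ℕ) → (Fin n → Carrier) → Carrier
  prodFin zero    g = 1#
  prodFin (suc n) g = g zero * prodFin n (λ i → g (suc i))

  Vect : Set → Set c
  Vect I = I → Carrier

  _≈ᵥ_ : {I : Set} → Vect I → Vect I → Set ℓ
  u ≈ᵥ v = ∀ i → u i ≈ v i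

  zeroV : {I : Set} → Vect I
  zeroV i = 0#

  _+ᵥ_ : {I : Set} → Vect I → Vect I → Vect I
  (u +ᵥ v) i = u i + v i

  _·ᵥ_ : {I : Set} → Carrier → Vect I → Vect I
  (a ·ᵥ v) i = a * v i

  NonZero : {I : Set} → Vect I → Set (ℓ)
  NonZero v = ¬ (v ≈ᵥ zeroV)

  -- a (vector) subspace of K^I; the projective subspace consists of the
  -- points ⟨x⟩ with x a nonzero vector of the subspace
  record Subspace (I : Set) (p : Level) : Set (c ⊔ ℓ ⊔ lsuc p) where
    field
      mem      : Vect I → Set p
      mem-resp : ∀ {u v} → u ≈ᵥ v → mem u → mem v
      mem-zero : mem zeroV
      mem-add  : ∀ {u v} → mem u → mem v → mem (u +ᵥ v)
      mem-scal : ∀ a {v} → mem v → mem (a ·ᵥ v)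

  linComb : {I : Set} → List (Carrier × Vect I) → Vect I
  linComb []             = zeroV
  linComb ((a , w) ∷ l) = (a ·ᵥ w) +ᵥ linComb l

  InSpan : {I : Set} {p : Level} → (Vect I → Set p) → Vect I → Set (c ⊔ ℓ ⊔ p)
  InSpan S v = Σ (List (Carrier × Vect _)) λ l →
    All (λ cw → S (proj₂ cw)) l × (v ≈ᵥ linComb l)

  -- the map α : PG(r-1,q^t) → PG(r^t-1,q^t) on representative vectors;
  -- coordinates are indexed by 𝔉 = functions {0..t-1} → {0..r-1};
  -- (α x)_f = Π_{i<t} x_{f(i)}^{q^i}
  α : (q r t : ℕ) → Vect (Fin r) → Vect (Fin t → Fin r)
  α q r t x f = prodFin t (λ i → pow (x (f i)) (q ^ toℕ i))

-- Pair K^𝔉 with the twisted Segre tensors (segre e φ)_f = ∏ᵢ φᵢ(f i)^{eᵢ} of linear forms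
-- φ₀, …, φ_{t-1} on K^r, so that α y = segre (i ↦ qⁱ) (i ↦ y).  As |K| is a power of p, K has
-- characteristic p, so every x ↦ x^{qⁱ} is additive and the pairing factorises:
-- ⟨segre e φ, α y⟩ = ∏ᵢ (φᵢ · y)^{qⁱ}.  Given α P as a linear combination of points α y with
-- y ∈ Πᵢ, choose for each i a form φᵢ vanishing on the finitely many such y of Πᵢ but not at P,
-- which exists because P ∉ Πᵢ.  Then ⟨segre e φ, -⟩ kills every α y of the combination (one
-- factor vanishes) but not α P, where no factor vanishes.
module Submission where

open import Defs
open import Level using (Level; _⊔_)
open import Algebra.Bundles using (CommutativeRing)
open import Data.Nat as ℕ using (ℕ; zero; suc; _≥_; _≤_; _<_; z≤n; s≤s; _!; _∸_)
import Data.Nat.Properties as ℕ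
open import Data.Nat.Combinatorics using (_C_; nCk≡n!/k![n-k]!; k![n∸k]!∣n!; nCn≡1)
open import Data.Nat.Divisibility using (_∣_; ∣1⇒≡1; ∣⇒≤; quotient; m∣n⇒n≡quotient*m; n/m≡quotient; m∣m*n)
open import Data.Nat.Primality using (Prime; euclidsLemma; prime⇒nonZero; ¬prime[0]; ¬prime[1])
open import Data.Fin as Fin using (Fin; zero; suc; toℕ)
import Data.Fin.Properties as Fin
open import Data.Fin.Permutation using (Permutation; permutation)
open import Data.List using (List; []; _∷_)
open import Data.List.Relation.Unary.All as All using (All; []; _∷_)
open import Data.List.Relation.Unary.Any using (here; there)
open import Data.List.Membership.Propositional using (_∈_)
open import Data.Product using (Σ; _,_; proj₁; proj₂; uncurry)
open import Data.Sum using (_⊎_; inj₁; inj₂)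
import Data.Sum as ⊎
open import Data.Empty using (⊥-elim)
open import Function using (_∘_)
open import Relation.Nullary using (¬_; ¬?; yes; no)
import Relation.Nullary.Decidable as Dec
open import Relation.Binary.Definitions using (Decidable)
open import Relation.Binary.PropositionalEquality as ≡ using (_≡_)

prime∤factorial : ∀ {p} → Prime p → ∀ m → m < p → ¬ p ∣ m !
prime∤factorial p-prime zero    _   p∣1 = ¬prime[1] (≡.subst Prime (∣1⇒≡1 p∣1) p-prime)
prime∤factorial p-prime (suc m) m<p p∣m! with euclidsLemma (suc m) (m !) p-prime p∣m!
... | inj₁ p∣1+m = ℕ.<⇒≱ m<p (∣⇒≤ p∣1+m)
... | inj₂ p∣m!  = prime∤factorial p-prime m (ℕ.<-trans (ℕ.n<1+n m) m<p) p∣m!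

n∣n! : ∀ n → .{{ℕ.NonZero n}} → n ∣ n !
n∣n! (suc n) = m∣m*n (n !)

p!≡pCk*k!*[p∸k]! : ∀ {p k} → k ≤ p → p ! ≡ (p C k) ℕ.* (k ! ℕ.* (p ∸ k) !)
p!≡pCk*k!*[p∸k]! {p} {k} k≤p = ≡.trans (m∣n⇒n≡quotient*m d∣p!)
  (≡.cong (ℕ._* (k ! ℕ.* (p ∸ k) !)) (≡.sym (≡.trans (nCk≡n!/k![n-k]! k≤p) (n/m≡quotient d∣p!))))
  where
  instance _ = k ℕ.!* (p ∸ k) !≢0
  d∣p! = k![n∸k]!∣n! k≤p

-- p divides p! = (p C k) · k! · (p - k)! but neither of the two factorials.
prime∣binomial : ∀ {p k} → Prime p → 0 < k → k < p → p ∣ p C k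
prime∣binomial {p} {k} p-prime 0<k k<p
  with euclidsLemma (p C k) _ p-prime
         (≡.subst (p ∣_) (p!≡pCk*k!*[p∸k]! (ℕ.<⇒≤ k<p)) (n∣n! p {{prime⇒nonZero p-prime}}))
... | inj₁ p∣pCk = p∣pCk
... | inj₂ p∣k!*[p∸k]! with euclidsLemma (k !) ((p ∸ k) !) p-prime p∣k!*[p∸k]!
...   | inj₁ p∣k!     = ⊥-elim (prime∤factorial p-prime k k<p p∣k!)
...   | inj₂ p∣[p∸k]! =
  ⊥-elim (prime∤factorial p-prime (p ∸ k) (ℕ.∸-monoʳ-< {p} {k} {0} 0<k (ℕ.<⇒≤ k<p)) p∣[p∸k]!)

module CommutativeRingProperties {c ℓ} (K : CommutativeRing c ℓ) where
  open CommutativeRing K hiding (zero)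
  open FieldTheory K
  open import Relation.Binary.Reasoning.Setoid setoid
  open import Algebra.Properties.Ring ring
    using (x+x≈x⇒x≈0; -‿distribˡ-*; +-identityʳ-unique; //-rightDividesˡ; //-rightDividesʳ)
  open import Algebra.Properties.CommutativeSemigroup *-commutativeSemigroup using (x∙yz≈y∙xz)
  open import Algebra.Properties.Semiring.Exp semiring using (_^_; ^-congˡ; ^-assocʳ)
  open import Algebra.Properties.CommutativeSemiring.Exp commutativeSemiring using (^-distrib-*)
  open import Algebra.Properties.Semiring.Mult semiring using (_×_; ×-assoc-*; ×-congʳ; ×-homo-1; ×1-homo-*)
  import Algebra.Properties.Semiring.Sum semiring as Sum
  open Sum using (sum)
  open import Algebra.Properties.CommutativeMonoid.Sum *-commutativeMonoid using ()
    renaming (sum to product; sum-cong-≋ to product-cong; ∑-distrib-+ to product-distrib-*)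
  import Algebra.Properties.CommutativeSemiring.Binomial commutativeSemiring as Binomial
  import Data.Vec.Functional as Vector

  record AdditiveExponent (m : ℕ) : Set (c ⊔ ℓ) where
    constructor additiveExponent
    field ^-distrib-+ : ∀ x y → (x + y) ^ m ≈ x ^ m + y ^ m
  open AdditiveExponent public

  additiveExponent-1 : AdditiveExponent 1
  additiveExponent-1 = additiveExponent λ x y →
    trans (*-identityʳ (x + y)) (+-cong (sym (*-identityʳ x)) (sym (*-identityʳ y)))

  additiveExponent-* : ∀ {m n} → AdditiveExponent m → AdditiveExponent n → AdditiveExponent (m ℕ.* n)
  additiveExponent-* {m} {n} m-additive n-additive = additiveExponent λ x y → begin
    (x + y) ^ (m ℕ.* n)         ≈⟨ ^-assocʳ (x + y) m n ⟨
    ((x + y) ^ m) ^ n           ≈⟨ ^-congˡ n (^-distrib-+ m-additive x y) ⟩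
    (x ^ m + y ^ m) ^ n         ≈⟨ ^-distrib-+ n-additive (x ^ m) (y ^ m) ⟩
    (x ^ m) ^ n + (y ^ m) ^ n   ≈⟨ +-cong (^-assocʳ x m n) (^-assocʳ y m n) ⟩
    x ^ (m ℕ.* n) + y ^ (m ℕ.* n) ∎

  additiveExponent-^ : ∀ {m} → AdditiveExponent m → ∀ k → AdditiveExponent (m ℕ.^ k)
  additiveExponent-^ m-additive zero    = additiveExponent-1
  additiveExponent-^ m-additive (suc k) = additiveExponent-* m-additive (additiveExponent-^ m-additive k)

  additiveExponent⇒0^≈0 : ∀ {m} → AdditiveExponent m → 0# ^ m ≈ 0#
  additiveExponent⇒0^≈0 {m} m-additive = x+x≈x⇒x≈0 (0# ^ m) (begin
    0# ^ m + 0# ^ m    ≈⟨ ^-distrib-+ m-additive 0# 0# ⟨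
    (0# + 0#) ^ m      ≈⟨ ^-congˡ m (+-identityʳ 0#) ⟩
    0# ^ m             ∎)

  ^-distrib-sum : ∀ {m} → AdditiveExponent m → ∀ {n} (v : Vect (Fin n)) → sum v ^ m ≈ sum (λ i → v i ^ m)
  ^-distrib-sum m-additive {zero}  v = additiveExponent⇒0^≈0 m-additive
  ^-distrib-sum m-additive {suc n} v =
    trans (^-distrib-+ m-additive (v zero) (sum (v ∘ suc))) (+-congˡ (^-distrib-sum m-additive (v ∘ suc)))

  p∣m⇒m×x≈0 : ∀ {p m} → p × 1# ≈ 0# → p ∣ m → ∀ x → m × x ≈ 0#
  p∣m⇒m×x≈0 {p} {m} p×1≈0 p∣m x = begin
    m × x                          ≈⟨ ×-congʳ m (*-identityˡ x) ⟨
    m × (1# * x)                   ≈⟨ ×-assoc-* m 1# x ⟨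
    (m × 1#) * x                   ≡⟨ ≡.cong (λ n → (n × 1#) * x) (m∣n⇒n≡quotient*m p∣m) ⟩
    ((quotient p∣m ℕ.* p) × 1#) * x  ≈⟨ *-congʳ (×1-homo-* (quotient p∣m) p) ⟩
    ((quotient p∣m × 1#) * (p × 1#)) * x  ≈⟨ *-congʳ (*-congˡ p×1≈0) ⟩
    ((quotient p∣m × 1#) * 0#) * x  ≈⟨ *-congʳ (zeroʳ _) ⟩
    0# * x                          ≈⟨ zeroˡ x ⟩
    0#                              ∎

  sum≈head+last : ∀ {n} (v : Vect (Fin (suc (suc n)))) → (∀ i → v (suc (Fin.inject₁ i)) ≈ 0#) →
    sum v ≈ v zero + v (Fin.fromℕ (suc n))
  sum≈head+last {n} v interior≈0 = +-congˡ (begin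
    sum (v ∘ suc)                                           ≈⟨ Sum.sum-init-last (v ∘ suc) ⟩
    sum (λ i → v (suc (Fin.inject₁ i))) + v (Fin.fromℕ (suc n))  ≈⟨ +-congʳ (Sum.sum-cong-≋ {n} interior≈0) ⟩
    sum {n} (λ _ → 0#) + v (Fin.fromℕ (suc n))                 ≈⟨ +-congʳ (Sum.sum-replicate-zero n) ⟩
    0# + v (Fin.fromℕ (suc n))                              ≈⟨ +-identityˡ _ ⟩
    v (Fin.fromℕ (suc n))                                   ∎)

  binomialTerm-first : ∀ x y n → Binomial.binomialTerm x y n zero ≈ y ^ n
  binomialTerm-first x y n = trans (×-homo-1 _) (*-identityˡ _)

  binomialTerm-last : ∀ x y n → Binomial.binomialTerm x y n (Fin.fromℕ n) ≈ x ^ n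
  binomialTerm-last x y n rewrite Fin.toℕ-fromℕ n | nCn≡1 n | ℕ.n∸n≡0 n = trans (×-homo-1 _) (*-identityʳ _)

  -- In characteristic p every binomial coefficient p C k with 0 < k < p vanishes.
  frobenius : ∀ {p} → Prime p → p × 1# ≈ 0# → AdditiveExponent p
  frobenius {0} p-prime = ⊥-elim (¬prime[0] p-prime)
  frobenius {1} p-prime = ⊥-elim (¬prime[1] p-prime)
  frobenius {p@(suc (suc n))} p-prime p×1≈0 = additiveExponent λ x y → begin
    (x + y) ^ p                                ≈⟨ Binomial.theorem p x y ⟩
    Binomial.binomialExpansion x y p           ≈⟨ sum≈head+last (Binomial.binomialTerm x y p) interior≈0 ⟩
    Binomial.binomialTerm x y p zero + Binomial.binomialTerm x y p (Fin.fromℕ p)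
                                               ≈⟨ +-cong (binomialTerm-first x y p) (binomialTerm-last x y p) ⟩
    y ^ p + x ^ p                              ≈⟨ +-comm _ _ ⟩
    x ^ p + y ^ p                              ∎
    where
    interior≈0 : ∀ {x y} (i : Fin (suc n)) → Binomial.binomialTerm x y p (suc (Fin.inject₁ i)) ≈ 0#
    interior≈0 i = p∣m⇒m×x≈0 p×1≈0
      (prime∣binomial p-prime (s≤s z≤n) (s≤s (≡.subst (ℕ._< suc n) (≡.sym (Fin.toℕ-inject₁ i)) (Fin.toℕ<n i)))) _

  module FiniteRing {N} (card : HasCardinality N) where
    enum : Fin N → Carrier
    enum = proj₁ card

    index : Carrier → Fin N
    index x = proj₁ (proj₂ (proj₂ card) x)

    enum∘index : ∀ x → enum (index x) ≈ x
    enum∘index x = proj₂ (proj₂ (proj₂ card) x)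

    index-unique : ∀ {i x} → enum i ≈ x → index x ≡ i
    index-unique {i} {x} eᵢ≈x = proj₁ (proj₂ card) (index x) i (trans (enum∘index x) (sym eᵢ≈x))

    _≟_ : Decidable _≈_
    x ≟ y = Dec.map′ index-injective (λ x≈y → ≡.sym (index-unique (trans (enum∘index x) x≈y)))
                     (index x Fin.≟ index y)
      where
      index-injective : index x ≡ index y → x ≈ y
      index-injective indices≡ = begin
        x                ≈⟨ enum∘index x ⟨
        enum (index x)   ≡⟨ ≡.cong enum indices≡ ⟩
        enum (index y)   ≈⟨ enum∘index y ⟩
        y                ∎

    translation : Carrier → Permutation N N
    translation a = permutation (λ i → index (enum i + a)) (λ i → index (enum i - a))
      (λ i → index-unique (sym (trans (+-congʳ (enum∘index _)) (//-rightDividesˡ a (enum i)))))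
      (λ i → index-unique (sym (trans (+-congʳ (enum∘index _)) (//-rightDividesʳ a (enum i)))))

    -- Translating by 1# permutes K, so ∑ x = ∑ (x + 1) = ∑ x + N · 1.
    N×1≈0 : N × 1# ≈ 0#
    N×1≈0 = +-identityʳ-unique (sum enum) (N × 1#) (sym (begin
      sum enum                                 ≈⟨ Sum.∑-permute enum (translation 1#) ⟩
      sum (λ i → enum (index (enum i + 1#)))    ≈⟨ Sum.sum-cong-≋ {N} (λ i → enum∘index (enum i + 1#)) ⟩
      sum (λ i → enum i + 1#)                  ≈⟨ Sum.∑-distrib-+ enum (λ _ → 1#) ⟩
      sum enum + sum {N} (λ _ → 1#)            ≈⟨ +-congˡ (Sum.sum-replicate N) ⟩
      sum enum + N × 1#                        ∎))

  record Summation (I : Set) : Set (c ⊔ ℓ) where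
    field
      ∑            : Vect I → Carrier
      ∑-cong       : ∀ {u v} → u ≈ᵥ v → ∑ u ≈ ∑ v
      ∑-distrib-+  : ∀ u v → ∑ (u +ᵥ v) ≈ ∑ u + ∑ v
      *-distribˡ-∑ : ∀ a v → a * ∑ v ≈ ∑ (a ·ᵥ v)

  sumFunctions : ∀ {r} t → Vect (Fin t → Fin r) → Carrier
  sumFunctions zero    g = g (λ ())
  sumFunctions (suc t) g = sum (λ a → sumFunctions t (λ f → g (a Vector.∷ f)))

  sumFunctions-cong : ∀ {r} t {g h : Vect (Fin t → Fin r)} → g ≈ᵥ h → sumFunctions t g ≈ sumFunctions t h
  sumFunctions-cong zero    g≈h = g≈h _
  sumFunctions-cong (suc t) g≈h = Sum.sum-cong-≋ (λ a → sumFunctions-cong t (λ f → g≈h (a Vector.∷ f)))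

  sumFunctions-distrib-+ : ∀ {r} t (g h : Vect (Fin t → Fin r)) →
    sumFunctions t (g +ᵥ h) ≈ sumFunctions t g + sumFunctions t h
  sumFunctions-distrib-+ zero    g h = refl
  sumFunctions-distrib-+ (suc t) g h =
    trans (Sum.sum-cong-≋ (λ a → sumFunctions-distrib-+ t (g ∘ (a Vector.∷_)) (h ∘ (a Vector.∷_))))
          (Sum.∑-distrib-+ (λ a → sumFunctions t (g ∘ (a Vector.∷_))) (λ a → sumFunctions t (h ∘ (a Vector.∷_))))

  *-distribˡ-sumFunctions : ∀ {r} t a (g : Vect (Fin t → Fin r)) → a * sumFunctions t g ≈ sumFunctions t (a ·ᵥ g)
  *-distribˡ-sumFunctions zero    a g = refl
  *-distribˡ-sumFunctions (suc t) a g =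
    trans (Sum.*-distribˡ-sum a (λ b → sumFunctions t (g ∘ (b Vector.∷_))))
          (Sum.sum-cong-≋ (λ b → *-distribˡ-sumFunctions t a (g ∘ (b Vector.∷_))))

  instance
    finSummation : ∀ {n} → Summation (Fin n)
    finSummation = record
      { ∑ = sum ; ∑-cong = Sum.sum-cong-≋ ; ∑-distrib-+ = Sum.∑-distrib-+ ; *-distribˡ-∑ = Sum.*-distribˡ-sum }

    functionSummation : ∀ {r t} → Summation (Fin t → Fin r)
    functionSummation {t = t} = record
      { ∑ = sumFunctions t ; ∑-cong = sumFunctions-cong t
      ; ∑-distrib-+ = sumFunctions-distrib-+ t ; *-distribˡ-∑ = *-distribˡ-sumFunctions t }

  sumFunctions-product : ∀ {r} t (h : Fin t → Vect (Fin r)) →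
    sumFunctions t (λ f → product (λ i → h i (f i))) ≈ product (λ i → sum (h i))
  sumFunctions-product zero    h = refl
  sumFunctions-product {r} (suc t) h = begin
    sum (λ a → sumFunctions t (λ f → h zero a * product (λ i → h (suc i) (f i))))
      ≈⟨ Sum.sum-cong-≋ (λ a → *-distribˡ-sumFunctions t (h zero a) _) ⟨
    sum (λ a → h zero a * sumFunctions t (λ f → product (λ i → h (suc i) (f i))))
      ≈⟨ Sum.sum-cong-≋ {r} (λ a → *-congˡ (sumFunctions-product t (h ∘ suc))) ⟩
    sum (λ a → h zero a * product (λ i → sum (h (suc i))))
      ≈⟨ Sum.*-distribʳ-sum (product (λ i → sum (h (suc i)))) (h zero) ⟨
    sum (h zero) * product (λ i → sum (h (suc i)))
      ∎

  infix 8 _∙_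
  _∙_ : ∀ {I} {{_ : Summation I}} → Vect I → Vect I → Carrier
  _∙_ {{S}} u v = Summation.∑ S (λ i → u i * v i)

  module _ {I} {{S : Summation I}} where
    open Summation S

    ∑-zero : ∑ zeroV ≈ 0#
    ∑-zero = begin
      ∑ zeroV              ≈⟨ ∑-cong (λ _ → zeroˡ 0#) ⟨
      ∑ (0# ·ᵥ zeroV)      ≈⟨ *-distribˡ-∑ 0# zeroV ⟨
      0# * ∑ zeroV         ≈⟨ zeroˡ _ ⟩
      0#                   ∎

    ∙-congʳ : ∀ (u : Vect I) {v w} → v ≈ᵥ w → u ∙ v ≈ u ∙ w
    ∙-congʳ u v≈w = ∑-cong (λ i → *-congˡ (v≈w i))

    ∙-distribˡ-+ : ∀ (u v w : Vect I) → u ∙ (v +ᵥ w) ≈ u ∙ v + u ∙ w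
    ∙-distribˡ-+ u v w = trans (∑-cong (λ i → distribˡ (u i) (v i) (w i))) (∑-distrib-+ _ _)

    ∙-distribʳ-+ : ∀ (u v w : Vect I) → (u +ᵥ v) ∙ w ≈ u ∙ w + v ∙ w
    ∙-distribʳ-+ u v w = trans (∑-cong (λ i → distribʳ (w i) (u i) (v i))) (∑-distrib-+ _ _)

    ∙-scaleʳ : ∀ (u : Vect I) a v → u ∙ (a ·ᵥ v) ≈ a * (u ∙ v)
    ∙-scaleʳ u a v = trans (∑-cong (λ i → x∙yz≈y∙xz (u i) a (v i))) (sym (*-distribˡ-∑ a _))

    ∙-scaleˡ : ∀ a (u v : Vect I) → (a ·ᵥ u) ∙ v ≈ a * (u ∙ v)
    ∙-scaleˡ a u v = trans (∑-cong (λ i → *-assoc a (u i) (v i))) (sym (*-distribˡ-∑ a _))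

    ∙-axpyˡ : ∀ (u : Vect I) a w v → (u +ᵥ (a ·ᵥ w)) ∙ v ≈ u ∙ v + a * (w ∙ v)
    ∙-axpyˡ u a w v = trans (∙-distribʳ-+ u (a ·ᵥ w) v) (+-congˡ (∙-scaleˡ a w v))

    ∙-axpyʳ : ∀ (u : Vect I) v a w → u ∙ (v +ᵥ (a ·ᵥ w)) ≈ u ∙ v + a * (u ∙ w)
    ∙-axpyʳ u v a w = trans (∙-distribˡ-+ u v (a ·ᵥ w)) (+-congˡ (∙-scaleʳ u a w))

    ∙-linComb : ∀ (u : Vect I) {l} → All (λ cw → u ∙ proj₂ cw ≈ 0#) l → u ∙ linComb l ≈ 0#
    ∙-linComb u [] = trans (∑-cong (λ i → zeroʳ (u i))) ∑-zero
    ∙-linComb u {(a , w) ∷ l} (u∙w≈0 ∷ u∙l≈0) = begin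
      u ∙ ((a ·ᵥ w) +ᵥ linComb l)        ≈⟨ ∙-distribˡ-+ u _ _ ⟩
      u ∙ (a ·ᵥ w) + u ∙ linComb l       ≈⟨ +-cong (∙-scaleʳ u a w) (∙-linComb u u∙l≈0) ⟩
      a * (u ∙ w) + 0#                   ≈⟨ +-congʳ (trans (*-congˡ u∙w≈0) (zeroʳ a)) ⟩
      0# + 0#                            ≈⟨ +-identityʳ 0# ⟩
      0#                                 ∎

    ∙-span : ∀ (u : Vect I) {p} {S : Vect I → Set p} {v} →
      (∀ {w} → S w → u ∙ w ≈ 0#) → InSpan S v → u ∙ v ≈ 0#
    ∙-span u u∙S≈0 (l , l⊆S , v≈l) = trans (∙-congʳ u v≈l) (∙-linComb u (All.map u∙S≈0 l⊆S))

  pow≡^ : ∀ x n → pow x n ≡ x ^ n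
  pow≡^ x zero    = ≡.refl
  pow≡^ x (suc n) = ≡.cong (x *_) (pow≡^ x n)

  prodFin≡product : ∀ n g → prodFin n g ≡ product g
  prodFin≡product zero    g = ≡.refl
  prodFin≡product (suc n) g = ≡.cong (g zero *_) (prodFin≡product n (g ∘ suc))

  segre : ∀ {r t} → (Fin t → ℕ) → (Fin t → Vect (Fin r)) → Vect (Fin t → Fin r)
  segre e φ f = product (λ i → φ i (f i) ^ e i)

  α≈segre : ∀ q {r t} (y : Vect (Fin r)) → α q r t y ≈ᵥ segre (λ i → q ℕ.^ toℕ i) (λ _ → y)
  α≈segre q {t = t} y f = trans (reflexive (prodFin≡product t _))
    (product-cong {t} (λ i → reflexive (pow≡^ (y (f i)) (q ℕ.^ toℕ i))))

  segre-∙ : ∀ {r t} {e : Fin t → ℕ} → (∀ i → AdditiveExponent (e i)) →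
    ∀ (φ ψ : Fin t → Vect (Fin r)) → segre e φ ∙ segre e ψ ≈ product (λ i → (φ i ∙ ψ i) ^ e i)
  segre-∙ {t = t} {e} additive φ ψ = begin
    sumFunctions t (λ f → segre e φ f * segre e ψ f)
      ≈⟨ sumFunctions-cong t (λ f → product-distrib-* (λ i → φ i (f i) ^ e i) (λ i → ψ i (f i) ^ e i)) ⟨
    sumFunctions t (λ f → product (λ i → φ i (f i) ^ e i * ψ i (f i) ^ e i))
      ≈⟨ sumFunctions-cong t (λ f → product-cong (λ i → ^-distrib-* (φ i (f i)) (ψ i (f i)) (e i))) ⟨
    sumFunctions t (λ f → product (λ i → (φ i (f i) * ψ i (f i)) ^ e i))
      ≈⟨ sumFunctions-product t (λ i a → (φ i a * ψ i a) ^ e i) ⟩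
    product (λ i → sum (λ a → (φ i a * ψ i a) ^ e i))
      ≈⟨ product-cong (λ i → ^-distrib-sum (additive i) (λ a → φ i a * ψ i a)) ⟨
    product (λ i → (φ i ∙ ψ i) ^ e i)
      ∎

  InSpan-mono : ∀ {I p p′} {S : Vect I → Set p} {T : Vect I → Set p′} {v} →
    (∀ {w} → S w → T w) → InSpan S v → InSpan T v
  InSpan-mono S⊆T (l , l⊆S , v≈l) = l , All.map S⊆T l⊆S , v≈l

  mem-span : ∀ {I p} (W : Subspace I p) {v} → InSpan (Subspace.mem W) v → Subspace.mem W v
  mem-span W (l , l⊆W , v≈l) = mem-resp (λ i → sym (v≈l i)) (mem-linComb l⊆W)
    where
    open Subspace W
    mem-linComb : ∀ {l} → All (mem ∘ proj₂) l → mem (linComb l)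
    mem-linComb []                        = mem-zero
    mem-linComb {(a , w) ∷ l} (w∈W ∷ l⊆W) = mem-add (mem-scal a w∈W) (mem-linComb l⊆W)

  unitVector : ∀ {n} → Fin n → Vect (Fin n)
  unitVector zero    zero    = 1#
  unitVector zero    (suc _) = 0#
  unitVector (suc j) zero    = 0#
  unitVector (suc j) (suc k) = unitVector j k

  unitVector-∙ : ∀ {n} (j : Fin n) v → unitVector j ∙ v ≈ v j
  unitVector-∙ {suc n} zero v =
    trans (+-cong (*-identityˡ (v zero)) (trans (Sum.sum-cong-≋ {n} (λ k → zeroˡ (v (suc k))))
                                                (Sum.sum-replicate-zero n)))
          (+-identityʳ (v zero))
  unitVector-∙ (suc j) v = trans (+-cong (zeroˡ (v zero)) (unitVector-∙ j (v ∘ suc))) (+-identityˡ (v (suc j)))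

  -x*y+x*y≈0 : ∀ x y → - x * y + x * y ≈ 0#
  -x*y+x*y≈0 x y = trans (+-congʳ (sym (-‿distribˡ-* x y))) (-‿inverseˡ (x * y))

  -x*y≈-y*x : ∀ x y → - x * y ≈ - y * x
  -x*y≈-y*x x y = trans (sym (-‿distribˡ-* x y)) (trans (-‿cong (*-comm x y)) (-‿distribˡ-* y x))

  product-zero : ∀ {n} (v : Vect (Fin n)) i → v i ≈ 0# → product v ≈ 0#
  product-zero v zero    v₀≈0 = trans (*-congʳ v₀≈0) (zeroˡ _)
  product-zero v (suc i) vᵢ≈0 = trans (*-congˡ (product-zero (v ∘ suc) i vᵢ≈0)) (zeroʳ _)

  record Separator {n} (S : List (Vect (Fin n))) (P : Vect (Fin n)) : Set (c ⊔ ℓ) where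
    field
      form    : Vect (Fin n)
      kills   : All (λ s → form ∙ s ≈ 0#) S
      detects : ¬ form ∙ P ≈ 0#

  separator-extend : ∀ {n} {S : List (Vect (Fin n))} {s P} → InSpan (_∈ S) s → Separator S P → Separator (s ∷ S) P
  separator-extend s∈⟨S⟩ σ = record
    { form = form ; kills = ∙-span form (All.lookup kills) s∈⟨S⟩ ∷ kills ; detects = detects }
    where open Separator σ

  module _ (isField : IsField) where
    open IsField isField

    x*y≈0⇒y≈0 : ∀ {x y} → ¬ x ≈ 0# → x * y ≈ 0# → y ≈ 0#
    x*y≈0⇒y≈0 {x} {y} x≉0 xy≈0 with inverse x x≉0
    ... | x⁻¹ , x*x⁻¹≈1 = begin
      y                ≈⟨ *-identityˡ y ⟨
      1# * y           ≈⟨ *-congʳ x*x⁻¹≈1 ⟨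
      (x * x⁻¹) * y    ≈⟨ *-congʳ (*-comm x x⁻¹) ⟩
      (x⁻¹ * x) * y    ≈⟨ *-assoc x⁻¹ x y ⟩
      x⁻¹ * (x * y)    ≈⟨ *-congˡ xy≈0 ⟩
      x⁻¹ * 0#         ≈⟨ zeroʳ x⁻¹ ⟩
      0#               ∎

    *-nonzero : ∀ {x y} → ¬ x ≈ 0# → ¬ y ≈ 0# → ¬ x * y ≈ 0#
    *-nonzero x≉0 y≉0 = y≉0 ∘ x*y≈0⇒y≈0 x≉0

    ^-nonzero : ∀ {x} → ¬ x ≈ 0# → ∀ n → ¬ x ^ n ≈ 0#
    ^-nonzero x≉0 zero    = 0≉1 ∘ sym
    ^-nonzero x≉0 (suc n) = *-nonzero x≉0 (^-nonzero x≉0 n)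

    product-nonzero : ∀ {n} (v : Vect (Fin n)) → (∀ i → ¬ v i ≈ 0#) → ¬ product v ≈ 0#
    product-nonzero {zero}  v v≉0 = 0≉1 ∘ sym
    product-nonzero {suc n} v v≉0 = *-nonzero (v≉0 zero) (product-nonzero (v ∘ suc) (v≉0 ∘ suc))

    -- A Gaussian elimination step: with ν ∙ s ≈ 1, both P ↦ P − (ν ∙ P) s and φ ↦ φ − (φ ∙ s) ν
    -- clear the s-direction, and φ′ ∙ P ≈ φ ∙ P′.
    module Elimination {n} {S : List (Vect (Fin n))} {s : Vect (Fin n)} (μ : Separator S s) where
      open Separator μ renaming (form to μ′; kills to μ-kills; detects to μ∙s≉0)

      ν : Vect (Fin n)
      ν = proj₁ (inverse (μ′ ∙ s) μ∙s≉0) ·ᵥ μ′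

      ν∙s≈1 : ν ∙ s ≈ 1#
      ν∙s≈1 = trans (∙-scaleˡ _ μ′ s) (trans (*-comm _ _) (proj₂ (inverse (μ′ ∙ s) μ∙s≉0)))

      ν-kills : All (λ t → ν ∙ t ≈ 0#) S
      ν-kills = All.map (λ μ∙t≈0 → trans (∙-scaleˡ _ μ′ _) (trans (*-congˡ μ∙t≈0) (zeroʳ _))) μ-kills

      eliminate : Vect (Fin n) → Vect (Fin n)
      eliminate P = P +ᵥ ((- (ν ∙ P)) ·ᵥ s)

      span-lift : ∀ {P} → InSpan (_∈ S) (eliminate P) → InSpan (_∈ s ∷ S) P
      span-lift {P} (l , l⊆S , P′≈l) = ((ν ∙ P , s) ∷ l) , here ≡.refl ∷ All.map there l⊆S , λ j → begin
        P j                                             ≈⟨ +-identityʳ (P j) ⟨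
        P j + 0#                                        ≈⟨ +-congˡ (-x*y+x*y≈0 (ν ∙ P) (s j)) ⟨
        P j + (- (ν ∙ P) * s j + ν ∙ P * s j)           ≈⟨ +-assoc (P j) _ _ ⟨
        (P j + - (ν ∙ P) * s j) + ν ∙ P * s j           ≈⟨ +-comm _ _ ⟩
        ν ∙ P * s j + (P j + - (ν ∙ P) * s j)           ≈⟨ +-congˡ (P′≈l j) ⟩
        ν ∙ P * s j + linComb l j                       ∎

      separator-lift : ∀ {P} → Separator S (eliminate P) → Separator (s ∷ S) P
      separator-lift {P} φ = record
        { form    = φ′
        ; kills   = φ′∙s≈0 ∷ All.zipWith (uncurry φ′-kills) (kills , ν-kills)
        ; detects = detects ∘ trans (sym φ′∙P≈φ∙P′)
        }
        where
        open Separator φ renaming (form to φ₀)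
        φ′ : Vect (Fin n)
        φ′ = φ₀ +ᵥ ((- (φ₀ ∙ s)) ·ᵥ ν)
        φ′-kills : ∀ {t} → φ₀ ∙ t ≈ 0# → ν ∙ t ≈ 0# → φ′ ∙ t ≈ 0#
        φ′-kills {t} φ∙t≈0 ν∙t≈0 = begin
          φ′ ∙ t                          ≈⟨ ∙-axpyˡ φ₀ _ ν t ⟩
          φ₀ ∙ t + - (φ₀ ∙ s) * (ν ∙ t)   ≈⟨ +-cong φ∙t≈0 (trans (*-congˡ ν∙t≈0) (zeroʳ _)) ⟩
          0# + 0#                         ≈⟨ +-identityʳ 0# ⟩
          0#                              ∎
        φ′∙s≈0 : φ′ ∙ s ≈ 0#
        φ′∙s≈0 = begin
          φ′ ∙ s                          ≈⟨ ∙-axpyˡ φ₀ _ ν s ⟩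
          φ₀ ∙ s + - (φ₀ ∙ s) * (ν ∙ s)   ≈⟨ +-congˡ (trans (*-congˡ ν∙s≈1) (*-identityʳ _)) ⟩
          φ₀ ∙ s + - (φ₀ ∙ s)             ≈⟨ -‿inverseʳ (φ₀ ∙ s) ⟩
          0#                              ∎
        φ′∙P≈φ∙P′ : φ′ ∙ P ≈ φ₀ ∙ eliminate P
        φ′∙P≈φ∙P′ = begin
          φ′ ∙ P                              ≈⟨ ∙-axpyˡ φ₀ _ ν P ⟩
          φ₀ ∙ P + - (φ₀ ∙ s) * (ν ∙ P)       ≈⟨ +-congˡ (-x*y≈-y*x (φ₀ ∙ s) (ν ∙ P)) ⟩
          φ₀ ∙ P + - (ν ∙ P) * (φ₀ ∙ s)       ≈⟨ ∙-axpyʳ φ₀ P _ s ⟨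
          φ₀ ∙ eliminate P                    ∎

    module _ (_≟_ : Decidable _≈_) where
      ^×1≈0⇒×1≈0 : ∀ n m → (n ℕ.^ m) × 1# ≈ 0# → n × 1# ≈ 0#
      ^×1≈0⇒×1≈0 n zero    1≈0 = ⊥-elim (0≉1 (sym (trans (sym (+-identityʳ 1#)) 1≈0)))
      ^×1≈0⇒×1≈0 n (suc m) nⁿ⁺¹≈0 with (n × 1#) ≟ 0#
      ... | yes n≈0 = n≈0
      ... | no  n≉0 = ^×1≈0⇒×1≈0 n m (x*y≈0⇒y≈0 n≉0 (trans (sym (×1-homo-* n (n ℕ.^ m))) nⁿ⁺¹≈0))

      span-or-separator : ∀ {n} (S : List (Vect (Fin n))) P → InSpan (_∈ S) P ⊎ Separator S P
      span-or-separator [] P with Fin.any? (λ j → ¬? (P j ≟ 0#))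
      ... | yes (j , Pⱼ≉0) =
        inj₂ (record { form = unitVector j ; kills = [] ; detects = Pⱼ≉0 ∘ trans (sym (unitVector-∙ j P)) })
      ... | no  P≈0        = inj₁ ([] , [] , λ j → Dec.decidable-stable (P j ≟ 0#) (P≈0 ∘ (j ,_)))
      span-or-separator (s ∷ S) P with span-or-separator S s
      ... | inj₁ s∈⟨S⟩ = ⊎.map (InSpan-mono there) (separator-extend s∈⟨S⟩) (span-or-separator S P)
      ... | inj₂ μ     = ⊎.map span-lift separator-lift (span-or-separator S (eliminate P))
        where open Elimination μ

    order-p^n⇒characteristic-p : ∀ {p n} → HasCardinality (p ℕ.^ n) → p × 1# ≈ 0#
    order-p^n⇒characteristic-p {p} {n} card = ^×1≈0⇒×1≈0 (FiniteRing._≟_ card) p n (FiniteRing.N×1≈0 card)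

open import Data.Product using (_×_)

module ImageSpan {c ℓ p} (K : CommutativeRing c ℓ) (isField : FieldTheory.IsField K)
  (_≟_ : Decidable (CommutativeRing._≈_ K)) (q r t : ℕ)
  (additive : ∀ (i : Fin t) → CommutativeRingProperties.AdditiveExponent K (q ℕ.^ toℕ i))
  (Π : Fin t → FieldTheory.Subspace K (Fin r) p) (P : FieldTheory.Vect K (Fin r))
  (P∉Π : ∀ i → ¬ FieldTheory.Subspace.mem (Π i) P) where
  open CommutativeRing K hiding (zero)
  open FieldTheory K
  open CommutativeRingProperties K
  open import Relation.Binary.Reasoning.Setoid setoid
  open import Algebra.Properties.Semiring.Exp semiring using (_^_; ^-congˡ)
  open import Algebra.Properties.CommutativeMonoid.Sum *-commutativeMonoid using () renaming (sum to product)

  e : Fin t → ℕ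
  e i = q ℕ.^ toℕ i

  InImage : Vect (Fin t → Fin r) → Set (c ⊔ ℓ ⊔ p)
  InImage v = Σ (Fin t) λ i → Σ (Vect (Fin r)) λ y → NonZero y × Subspace.mem (Π i) y × v ≈ᵥ α q r t y

  Generators : List (Carrier × Vect (Fin t → Fin r)) → Set (c ⊔ ℓ ⊔ p)
  Generators = All (InImage ∘ proj₂)

  generatorsIn : Fin t → ∀ {l} → Generators l → List (Vect (Fin r))
  generatorsIn i []                = []
  generatorsIn i ((j , y , _) ∷ A) with j Fin.≟ i
  ... | yes _ = y ∷ generatorsIn i A
  ... | no  _ = generatorsIn i A

  generatorsIn-⊆ : ∀ i {l} (A : Generators l) → All (Subspace.mem (Π i)) (generatorsIn i A)
  generatorsIn-⊆ i []                             = []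
  generatorsIn-⊆ i ((j , y , _ , y∈Πⱼ , _) ∷ A) with j Fin.≟ i
  ... | yes ≡.refl = y∈Πⱼ ∷ generatorsIn-⊆ i A
  ... | no  _      = generatorsIn-⊆ i A

  module _ {z} {Z : Vect (Fin r) → Set z} where
    generatorsIn-head : ∀ {cw l} j y rest (A : Generators l) →
      All Z (generatorsIn j {cw ∷ l} ((j , y , rest) ∷ A)) → Z y
    generatorsIn-head j y rest A Zs with j Fin.≟ j
    ... | yes _  = All.head Zs
    ... | no j≢j = ⊥-elim (j≢j ≡.refl)

    generatorsIn-tail : ∀ {cw l} i g (A : Generators l) →
      All Z (generatorsIn i {cw ∷ l} (g ∷ A)) → All Z (generatorsIn i A)
    generatorsIn-tail i (j , _) A Zs with j Fin.≟ i
    ... | yes _ = All.tail Zs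
    ... | no  _ = Zs

  separator : ∀ {l} (A : Generators l) i → Separator (generatorsIn i A) P
  separator A i with span-or-separator isField _≟_ (generatorsIn i A) P
  ... | inj₁ P∈⟨Πᵢ⟩ = ⊥-elim (P∉Π i (mem-span (Π i) (InSpan-mono (All.lookup (generatorsIn-⊆ i A)) P∈⟨Πᵢ⟩)))
  ... | inj₂ σ      = σ

  segre∙α : ∀ (φ : Fin t → Vect (Fin r)) y → segre e φ ∙ α q r t y ≈ product (λ i → (φ i ∙ y) ^ e i)
  segre∙α φ y = trans (∙-congʳ (segre e φ) (α≈segre q y)) (segre-∙ additive φ (λ _ → y))

  segre-kills : ∀ (φ : Fin t → Vect (Fin r)) {l} (A : Generators l) →
    (∀ i → All (λ s → φ i ∙ s ≈ 0#) (generatorsIn i A)) → All (λ cw → segre e φ ∙ proj₂ cw ≈ 0#) l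
  segre-kills φ [] _ = []
  segre-kills φ {(a , w) ∷ l} (g@(j , y , rest@(_ , _ , w≈αy)) ∷ A) φ-kills =
    w-killed ∷ segre-kills φ A (λ i → generatorsIn-tail {Z = λ s → φ i ∙ s ≈ 0#} {a , w} i g A (φ-kills i))
    where
    w-killed : segre e φ ∙ w ≈ 0#
    w-killed = begin
      segre e φ ∙ w                     ≈⟨ ∙-congʳ (segre e φ) w≈αy ⟩
      segre e φ ∙ α q r t y             ≈⟨ segre∙α φ y ⟩
      product (λ i → (φ i ∙ y) ^ e i)   ≈⟨ product-zero _ j [φⱼ∙y]^eⱼ≈0 ⟩
      0#                                ∎
      where
      [φⱼ∙y]^eⱼ≈0 : (φ j ∙ y) ^ e j ≈ 0#
      [φⱼ∙y]^eⱼ≈0 = trans (^-congˡ (e j) (generatorsIn-head {cw = a , w} j y rest A (φ-kills j)))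
                          (additiveExponent⇒0^≈0 (additive j))

  α-image-not-in-span : ¬ InSpan InImage (α q r t P)
  α-image-not-in-span (l , A , αP≈l) =
    product-nonzero isField _ (λ i → ^-nonzero isField (Separator.detects (σ i)) (e i)) (begin
      product (λ i → (φ i ∙ P) ^ e i)   ≈⟨ segre∙α φ P ⟨
      segre e φ ∙ α q r t P             ≈⟨ ∙-congʳ (segre e φ) αP≈l ⟩
      segre e φ ∙ linComb l             ≈⟨ ∙-linComb (segre e φ) (segre-kills φ A (Separator.kills ∘ σ)) ⟩
      0#                                ∎)
    where
    σ = separator A
    φ = Separator.form ∘ σ

open import Data.Nat using (_^_)
open import Data.Nat.Properties using (^-*-assoc)

mainTheorem1 : {c ℓ p : Level} (K : CommutativeRing c ℓ) (q r t : ℕ) →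
    IsPrimePower q → r ≥ 2 → t ≥ 2 →
    FieldTheory.IsField K → FieldTheory.HasCardinality K (q ^ t) →
    (Π : Fin t → FieldTheory.Subspace K (Fin r) p) →
    (P : FieldTheory.Vect K (Fin r)) → FieldTheory.NonZero K P →
    (∀ i → ¬ FieldTheory.Subspace.mem (Π i) P) →
    ¬ FieldTheory.InSpan K
        (λ v → Σ (Fin t) λ i → Σ (FieldTheory.Vect K (Fin r)) λ y →
           FieldTheory.NonZero K y × FieldTheory.Subspace.mem (Π i) y ×
           FieldTheory._≈ᵥ_ K v (FieldTheory.α K q r t y))
        (FieldTheory.α K q r t P)
mainTheorem1 K _ r t (p , e , p-prime , _ , ≡.refl) _ _ isField card Π P _ P∉Π =
  ImageSpan.α-image-not-in-span K isField (FiniteRing._≟_ card) (p ^ e) r t qⁱ-additive Π P P∉Π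
  where
  open CommutativeRingProperties K
  p-additive : AdditiveExponent p
  p-additive = frobenius p-prime (order-p^n⇒characteristic-p isField {p} {e ℕ.* t}
    (≡.subst (FieldTheory.HasCardinality K) (^-*-assoc p e t) card))
  qⁱ-additive : ∀ (i : Fin t) → AdditiveExponent ((p ^ e) ^ toℕ i)
  qⁱ-additive i = additiveExponent-^ (additiveExponent-^ p-additive e) (toℕ i)
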